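{- Let $$D^{\mathrm{sol},\ell}(x,y;q):=\sum_{\lambda\in\mathcal{D}}x^{\mathrm{sol}(\lambda)}y^{\ell(\lambda)}q^{|\lambda|}.$$ Then, as formal power series, $$D^{\mathrm{sol},\ell}(x,y;q)=\sum_{i,j\ge 0}\frac{x^iy^{i+2j}q^{i^2+2ij+2j^2+j}}{(q;q)_i(q^2;q^2)_j}.$$
   Context: For $n\ge1$, $(a;q)_n=(1-a)(1-aq)\cdots(1-aq^{n-1})$ and $(a;q)_0=1$. A partition is written as a weakly increasing list of positive integers $\lambda_1\le\cdots\le\lambda_m$; $|\lambda|$ is the sum of its parts and $\ell(\lambda)=m$ is the number of parts. $\mathcal{D}$ denotes the set of strict partitions (all parts distinct), including the empty partition. A sequence of a strict partition $\lambda$ is a maximal string of consecutive integers all of which are parts of $\lambda$; every strict partition splits uniquely into sequences. $\mathrm{sol}(\lambda)$ is the number of sequences of $\lambda$ whose length (number of parts) is odd. -}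

module Defs where

open import Data.Nat using (ℕ; zero; suc; _+_; _*_; _∸_; _<_; _≡ᵇ_; _≤ᵇ_; _%_)
open import Data.Bool using (Bool; true; false; if_then_else_; _∧_)
open import Data.List using (List; []; _∷_; length; map; upTo)
open import Data.Nat.ListAction using (sum)
open import Data.List.Relation.Unary.All using (All)
open import Data.List.Relation.Unary.Linked using (Linked)
open import Data.Product using (_×_)

IsStrictPartition : List ℕ → Set
IsStrictPartition λs = All (λ p → 0 < p) λs × Linked _<_ λs

-- Lengths of the sequences (maximal runs of consecutive integers)
-- of an increasing list, in order.
runsFrom : ℕ → ℕ → List ℕ → List ℕ
runsFrom prev len [] = len ∷ []
runsFrom prev len (y ∷ ys) =
  if y ≡ᵇ suc prev then runsFrom y (suc len) ys else (len ∷ runsFrom y 1 ys)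

runs : List ℕ → List ℕ
runs [] = []
runs (x ∷ xs) = runsFrom x 1 xs

countOdd : List ℕ → ℕ
countOdd [] = 0
countOdd (r ∷ rs) = (if r % 2 ≡ᵇ 1 then 1 else 0) + countOdd rs

sol : List ℕ → ℕ
sol λs = countOdd (runs λs)

-- Formal power series in q with ℕ coefficients: n ↦ [q^n].

Series : Set
Series = ℕ → ℕ

sumTo : ℕ → (ℕ → ℕ) → ℕ
sumTo n f = sum (map f (upTo (suc n)))

oneS : Series
oneS zero = 1
oneS (suc _) = 0

_⊛_ : Series → Series → Series
(f ⊛ g) n = sumTo n (λ k → f k * g (n ∸ k))

-- geo m = 1/(1 - q^(m+1)) = Σ_{t≥0} q^{t(m+1)}
geo : ℕ → Series
geo m n = if n % suc m ≡ᵇ 0 then 1 else 0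

-- 1/(q;q)_i = Π_{k=1}^{i} 1/(1-q^k)
invQPoch : ℕ → Series
invQPoch zero = oneS
invQPoch (suc i) = invQPoch i ⊛ geo i

-- 1/(q^2;q^2)_j = Π_{k=1}^{j} 1/(1-q^{2k})
invQ2Poch : ℕ → Series
invQ2Poch zero = oneS
invQ2Poch (suc j) = invQ2Poch j ⊛ geo (suc (2 * j))

expo : ℕ → ℕ → ℕ
expo i j = i * i + 2 * i * j + 2 * j * j + j

-- coefficient of x^a y^b q^n in  x^i y^{i+2j} q^{expo i j} / ((q;q)_i (q^2;q^2)_j)
term : ℕ → ℕ → ℕ → ℕ → ℕ → ℕ
term i j a b n =
  if (a ≡ᵇ i) ∧ (b ≡ᵇ i + 2 * j) ∧ (expo i j ≤ᵇ n)
  then (invQPoch i ⊛ invQ2Poch j) (n ∸ expo i j)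
  else 0

-- coefficient of x^a y^b q^n in the double sum over i, j ≥ 0.
-- Terms with i > n or j > n have q-exponent > n, so contribute nothing.
rhsCoeff : ℕ → ℕ → ℕ → ℕ
rhsCoeff a b n = sumTo n (λ i → sumTo n (λ j → term i j a b n))

{-# OPTIONS --safe #-}
module Submission where

-- A nonempty strict partition μ with b parts is, according to its smallest parts, exactly one of
-- ν + 1 (all parts ≥ 2), {1} ∪ (ν + 2) (the part 1 is a sequence on its own) or {1, 2} ∪ (ν + 2),
-- for a strict ν with b, b − 1 or b − 2 parts. The first form keeps sol, the second adds the odd
-- sequence {1}, and the third either puts 1, 2 in front of the first sequence of ν + 2 or adds the
-- even sequence {1, 2}, so it keeps sol as well. Listing strict partitions along this decomposition,
-- the number C(a, b, n) of those with sol = a, b parts and size n satisfies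
--   C(a, b, n) = C(a, b, n − b) + C(a − 1, b − 1, n − 2b + 1) + C(a, b − 2, n − 2b + 1).
-- With b = i + 2j, the summand F(i, j) = q^(i²+2ij+2j²+j) / ((q;q)_i (q²;q²)_j) satisfies
--   F(i, j) = q^b F(i, j) + q^(2b−1) (F(i − 1, j) + F(i, j − 1)),
-- by 1/(q;q)_i = 1/(q;q)_(i−1) + q^i/(q;q)_i and 1/(q²;q²)_j = 1/(q²;q²)_(j−1) + q^(2j)/(q²;q²)_j,
-- so the coefficient of x^a y^b q^n of the double sum obeys the same recurrence and initial values.

open import Defs
open import Algebra.Properties.CommutativeSemigroup using (interchange)
open import Data.Bool using (true; false; if_then_else_)
open import Data.Bool.Properties using (T-≡; ¬-not)
open import Data.Empty using (⊥)
open import Data.List using (List; []; _∷_; [_]; _++_; length; map; upTo; applyUpTo)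
open import Data.List.Membership.Propositional using (_∈_)
open import Data.List.Membership.Propositional.Properties using (∈-map⁻; ∈-map⁺; ∈-++⁻; ∈-++⁺ˡ; ∈-++⁺ʳ)
open import Data.List.Properties
  using (length-++; length-map; map-cong; map-injective; map-upTo; applyUpTo-∷ʳ; ∷-injectiveʳ)
open import Data.List.Relation.Binary.Disjoint.Propositional using (Disjoint)
open import Data.List.Relation.Unary.All using (All; []; _∷_)
import Data.List.Relation.Unary.All as All
import Data.List.Relation.Unary.All.Properties as All
import Data.List.Relation.Unary.AllPairs as AllPairs
open import Data.List.Relation.Unary.Any using (here)
open import Data.List.Relation.Unary.Linked using (Linked; []; [-]; _∷_)
import Data.List.Relation.Unary.Linked as Linked
import Data.List.Relation.Unary.Linked.Properties as Linked
open import Data.List.Relation.Unary.Linked.Properties using (Linked⇒All; Linked⇒AllPairs)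
open import Data.List.Relation.Unary.Unique.Propositional using (Unique)
import Data.List.Relation.Unary.Unique.Propositional.Properties as Unique
open import Data.Nat using (ℕ; zero; suc; _+_; _*_; _∸_; _%_; _<_; _≤_; _≤ᵇ_; _≡ᵇ_; z<s; s<s; z≤n; s≤s; s≤s⁻¹)
open import Data.Nat.DivMod using ([m+n]%n≡m%n; m<n⇒m%n≡m)
open import Data.Nat.ListAction using (sum)
open import Data.Nat.ListAction.Properties using (sum-++)
open import Data.Nat.Properties
open import Data.Nat.Tactic.RingSolver using (solve-∀)
open import Data.Product using (Σ; _×_; _,_; proj₁; proj₂; ∃-syntax)
import Data.Product as Product
open import Data.Sum using (inj₁; inj₂; [_,_]′)
open import Function using (_∘_)
open import Function.Bundles using (_⇔_; Equivalence; mk⇔)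
open import Relation.Binary.PropositionalEquality
  using (_≡_; _≢_; _≗_; refl; sym; trans; cong; cong₂; subst; module ≡-Reasoning)
open import Relation.Nullary using (¬_; Dec; yes; no; contradiction)
open import Relation.Nullary.Decidable using (map′)
open import Relation.Nullary.Reflects using (ofʸ; ofⁿ)

sumBelow : ℕ → (ℕ → ℕ) → ℕ
sumBelow n f = sum (applyUpTo f n)

sumTo≡sumBelow : ∀ n f → sumTo n f ≡ sumBelow (suc n) f
sumTo≡sumBelow n f = cong sum (map-upTo f (suc n))

sumBelow-cong : ∀ n {f g : ℕ → ℕ} → (∀ {k} → k < n → f k ≡ g k) → sumBelow n f ≡ sumBelow n g
sumBelow-cong zero    f≡g = refl
sumBelow-cong (suc n) f≡g = cong₂ _+_ (f≡g z<s) (sumBelow-cong n (f≡g ∘ s<s))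

sumBelow-zero : ∀ n {f : ℕ → ℕ} → (∀ {k} → k < n → f k ≡ 0) → sumBelow n f ≡ 0
sumBelow-zero zero    f≡0 = refl
sumBelow-zero (suc n) f≡0 = cong₂ _+_ (f≡0 z<s) (sumBelow-zero n (f≡0 ∘ s<s))

sumBelow-distrib-+ : ∀ n (f g : ℕ → ℕ) → sumBelow n (λ k → f k + g k) ≡ sumBelow n f + sumBelow n g
sumBelow-distrib-+ zero    f g = refl
sumBelow-distrib-+ (suc n) f g =
  trans (cong (f 0 + g 0 +_) (sumBelow-distrib-+ n (f ∘ suc) (g ∘ suc)))
        (interchange +-commutativeSemigroup (f 0) (g 0) (sumBelow n (f ∘ suc)) (sumBelow n (g ∘ suc)))

sumBelow-+ : ∀ m n (f : ℕ → ℕ) → sumBelow (m + n) f ≡ sumBelow m f + sumBelow n (λ k → f (m + k))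
sumBelow-+ zero    n f = refl
sumBelow-+ (suc m) n f = trans (cong (f 0 +_) (sumBelow-+ m n (f ∘ suc))) (sym (+-assoc (f 0) _ _))

sumBelow-suc : ∀ n (f : ℕ → ℕ) → sumBelow (suc n) f ≡ sumBelow n f + f n
sumBelow-suc n f = begin
  sum (applyUpTo f (suc n))        ≡⟨ cong sum (applyUpTo-∷ʳ f n) ⟨
  sum (applyUpTo f n ++ [ f n ])   ≡⟨ sum-++ (applyUpTo f n) [ f n ] ⟩
  sumBelow n f + (f n + 0)         ≡⟨ cong (sumBelow n f +_) (+-identityʳ (f n)) ⟩
  sumBelow n f + f n               ∎
  where open ≡-Reasoning

sumBelow-reverse : ∀ n (f : ℕ → ℕ) → sumBelow n f ≡ sumBelow n (λ k → f (n ∸ suc k))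
sumBelow-reverse zero    f = refl
sumBelow-reverse (suc n) f = begin
  f 0 + sumBelow n (f ∘ suc)                     ≡⟨ cong (f 0 +_) (sumBelow-reverse n (f ∘ suc)) ⟩
  f 0 + sumBelow n (λ k → f (suc (n ∸ suc k)))   ≡⟨ +-comm (f 0) _ ⟩
  sumBelow n (λ k → f (suc (n ∸ suc k))) + f 0   ≡⟨ cong₂ _+_ (sumBelow-cong n (cong f ∘ sym ∘ +-∸-assoc 1))
                                                              (cong f (sym (n∸n≡0 n))) ⟩
  sumBelow n (λ k → f (n ∸ k)) + f (n ∸ n)       ≡⟨ sumBelow-suc n (λ k → f (n ∸ k)) ⟨
  sumBelow (suc n) (λ k → f (n ∸ k))             ∎
  where open ≡-Reasoning

sumBelow-delta : ∀ n a {f : ℕ → ℕ} → (∀ {k} → k ≢ a → f k ≡ 0) → (n ≤ a → f a ≡ 0) → sumBelow n f ≡ f a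
sumBelow-delta zero    a           f≡0 fa≡0 = sym (fa≡0 z≤n)
sumBelow-delta (suc n) zero    {f} f≡0 fa≡0 =
  trans (cong (f 0 +_) (sumBelow-zero n λ _ → f≡0 λ ())) (+-identityʳ (f 0))
sumBelow-delta (suc n) (suc a) {f} f≡0 fa≡0 =
  trans (cong (_+ sumBelow n (f ∘ suc)) (f≡0 λ ()))
        (sumBelow-delta n a (λ k≢a → f≡0 (k≢a ∘ suc-injective)) (fa≡0 ∘ s≤s))

-- Formal power series

_⊕_ : Series → Series → Series
(f ⊕ g) n = f n + g n

-- multiplication by q^d
shift : ℕ → Series → Series
shift d f n = if d ≤ᵇ n then f (n ∸ d) else 0

shift-suc : ∀ d (f : Series) n → shift (suc d) f (suc n) ≡ shift d f n
shift-suc zero    f n = refl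
shift-suc (suc d) f n = refl

shift-≤ : ∀ {d n} (f : Series) → d ≤ n → shift d f n ≡ f (n ∸ d)
shift-≤         f z≤n       = refl
shift-≤ {suc d} f (s≤s d≤n) = trans (shift-suc d f _) (shift-≤ f d≤n)

shift-> : ∀ {d n} (f : Series) → n < d → shift d f n ≡ 0
shift-> {suc d} {zero}  f _         = refl
shift-> {suc d} {suc n} f (s≤s n<d) = trans (shift-suc d f n) (shift-> f n<d)

shift-cong-at : ∀ d n {f g : Series} → (d ≤ n → f (n ∸ d) ≡ g (n ∸ d)) → shift d f n ≡ shift d g n
shift-cong-at d n {f} {g} f≡g with d ≤? n
... | yes d≤n = trans (shift-≤ f d≤n) (trans (f≡g d≤n) (sym (shift-≤ g d≤n)))
... | no  d≰n = trans (shift-> f (≰⇒> d≰n)) (sym (shift-> g (≰⇒> d≰n)))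

shift-cong : ∀ d {f g : Series} → f ≗ g → shift d f ≗ shift d g
shift-cong d {f} {g} f≗g n = shift-cong-at d n {f} {g} (λ _ → f≗g (n ∸ d))

shift-zero : ∀ d → shift d (λ _ → 0) ≗ λ _ → 0
shift-zero d n with d ≤ᵇ n
... | true  = refl
... | false = refl

shift-⊕ : ∀ d (f g : Series) → shift d (f ⊕ g) ≗ shift d f ⊕ shift d g
shift-⊕ d f g n with d ≤ᵇ n
... | true  = refl
... | false = refl

shift-shift : ∀ d e (f : Series) → shift d (shift e f) ≗ shift (d + e) f
shift-shift zero    e f n       = refl
shift-shift (suc d) e f zero    = refl
shift-shift (suc d) e f (suc n) =
  trans (shift-suc d (shift e f) n) (trans (shift-shift d e f n) (sym (shift-suc (d + e) f n)))

⊛-unfold : ∀ (f g : Series) n → (f ⊛ g) n ≡ sumBelow (suc n) (λ k → f k * g (n ∸ k))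
⊛-unfold f g n = sumTo≡sumBelow n _

⊛-congˡ : ∀ {f f′ : Series} (g : Series) → f ≗ f′ → f ⊛ g ≗ f′ ⊛ g
⊛-congˡ g f≗f′ n = cong sum (map-cong (λ k → cong (_* g (n ∸ k)) (f≗f′ k)) (upTo (suc n)))

⊛-congʳ : ∀ (f : Series) {g g′ : Series} → g ≗ g′ → f ⊛ g ≗ f ⊛ g′
⊛-congʳ f g≗g′ n = cong sum (map-cong (λ k → cong (f k *_) (g≗g′ (n ∸ k))) (upTo (suc n)))

⊛-comm : ∀ (f g : Series) → f ⊛ g ≗ g ⊛ f
⊛-comm f g n = begin
  (f ⊛ g) n                                              ≡⟨ ⊛-unfold f g n ⟩
  sumBelow (suc n) (λ k → f k * g (n ∸ k))               ≡⟨ sumBelow-reverse (suc n) (λ k → f k * g (n ∸ k)) ⟩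
  sumBelow (suc n) (λ k → f (n ∸ k) * g (n ∸ (n ∸ k)))   ≡⟨ sumBelow-cong (suc n) swap ⟩
  sumBelow (suc n) (λ k → g k * f (n ∸ k))               ≡⟨ ⊛-unfold g f n ⟨
  (g ⊛ f) n                                              ∎
  where
  open ≡-Reasoning
  swap : ∀ {k} → k < suc n → f (n ∸ k) * g (n ∸ (n ∸ k)) ≡ g k * f (n ∸ k)
  swap {k} k<1+n =
    trans (cong (λ m → f (n ∸ k) * g m) (m∸[m∸n]≡n (s≤s⁻¹ k<1+n))) (*-comm (f (n ∸ k)) (g k))

⊛-identityˡ : ∀ (f : Series) → oneS ⊛ f ≗ f
⊛-identityˡ f n = begin
  (oneS ⊛ f) n                                  ≡⟨ ⊛-unfold oneS f n ⟩
  sumBelow (suc n) (λ k → oneS k * f (n ∸ k))   ≡⟨ sumBelow-delta (suc n) 0 off-zero (λ ()) ⟩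
  f n + 0                                       ≡⟨ +-identityʳ (f n) ⟩
  f n                                           ∎
  where
  open ≡-Reasoning
  off-zero : ∀ {k} → k ≢ 0 → oneS k * f (n ∸ k) ≡ 0
  off-zero {zero}  k≢0 = contradiction refl k≢0
  off-zero {suc k} _   = refl

⊛-identityʳ : ∀ (f : Series) → f ⊛ oneS ≗ f
⊛-identityʳ f n = trans (⊛-comm f oneS n) (⊛-identityˡ f n)

⊛-distribʳ-⊕ : ∀ (f g h : Series) → (f ⊕ g) ⊛ h ≗ (f ⊛ h) ⊕ (g ⊛ h)
⊛-distribʳ-⊕ f g h n = begin
  ((f ⊕ g) ⊛ h) n
    ≡⟨ ⊛-unfold (f ⊕ g) h n ⟩
  sumBelow (suc n) (λ k → (f k + g k) * h (n ∸ k))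
    ≡⟨ sumBelow-cong (suc n) (λ {k} _ → *-distribʳ-+ (h (n ∸ k)) (f k) (g k)) ⟩
  sumBelow (suc n) (λ k → fh k + gh k)
    ≡⟨ sumBelow-distrib-+ (suc n) fh gh ⟩
  sumBelow (suc n) fh + sumBelow (suc n) gh
    ≡⟨ cong₂ _+_ (⊛-unfold f h n) (⊛-unfold g h n) ⟨
  (f ⊛ h) n + (g ⊛ h) n
    ∎
  where
  open ≡-Reasoning
  fh gh : ℕ → ℕ
  fh k = f k * h (n ∸ k)
  gh k = g k * h (n ∸ k)

⊛-distribˡ-⊕ : ∀ (f g h : Series) → f ⊛ (g ⊕ h) ≗ (f ⊛ g) ⊕ (f ⊛ h)
⊛-distribˡ-⊕ f g h n =
  trans (⊛-comm f (g ⊕ h) n) (trans (⊛-distribʳ-⊕ g h f n) (cong₂ _+_ (⊛-comm g f n) (⊛-comm h f n)))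

shift-⊛ : ∀ d (f g : Series) → shift d f ⊛ g ≗ shift d (f ⊛ g)
shift-⊛ d f g n with d ≤? n
... | no d≰n = trans (⊛-unfold (shift d f) g n) (trans (sumBelow-zero (suc n) vanish) (sym (shift-> (f ⊛ g) n<d)))
  where
  n<d = ≰⇒> d≰n
  vanish : ∀ {k} → k < suc n → shift d f k * g (n ∸ k) ≡ 0
  vanish {k} k<1+n = cong (_* g (n ∸ k)) (shift-> f (<-≤-trans k<1+n n<d))
... | yes d≤n = begin
  (shift d f ⊛ g) n                                         ≡⟨ ⊛-unfold (shift d f) g n ⟩
  sumBelow (suc n) F                                        ≡⟨ cong (λ m → sumBelow m F) split ⟨
  sumBelow (d + suc (n ∸ d)) F                              ≡⟨ sumBelow-+ d (suc (n ∸ d)) F ⟩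
  sumBelow d F + sumBelow (suc (n ∸ d)) (λ k → F (d + k))   ≡⟨ cong₂ _+_ (sumBelow-zero d below)
                                                                         (sumBelow-cong (suc (n ∸ d)) (λ {k} _ → above k)) ⟩
  sumBelow (suc (n ∸ d)) (λ k → f k * g (n ∸ d ∸ k))        ≡⟨ ⊛-unfold f g (n ∸ d) ⟨
  (f ⊛ g) (n ∸ d)                                           ≡⟨ shift-≤ (f ⊛ g) d≤n ⟨
  shift d (f ⊛ g) n                                         ∎
  where
  open ≡-Reasoning
  F : ℕ → ℕ
  F k = shift d f k * g (n ∸ k)
  split : d + suc (n ∸ d) ≡ suc n
  split = trans (+-suc d (n ∸ d)) (cong suc (m+[n∸m]≡n d≤n))
  below : ∀ {k} → k < d → F k ≡ 0
  below {k} k<d = cong (_* g (n ∸ k)) (shift-> f k<d)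
  above : ∀ k → F (d + k) ≡ f k * g (n ∸ d ∸ k)
  above k = cong₂ _*_ (trans (shift-≤ f (m≤m+n d k)) (cong f (m+n∸m≡n d k))) (cong g (sym (∸-+-assoc n d k)))

⊛-shift : ∀ d (f g : Series) → f ⊛ shift d g ≗ shift d (f ⊛ g)
⊛-shift d f g n = trans (⊛-comm f (shift d g) n) (trans (shift-⊛ d g f n) (shift-cong d (⊛-comm g f) n))

geo-unfold : ∀ k → geo k ≗ oneS ⊕ shift (suc k) (geo k)
geo-unfold k n with suc k ≤? n
... | yes k<n@(s≤s _) = trans (cong (λ r → if r ≡ᵇ 0 then 1 else 0) periodic) (sym (shift-≤ (geo k) k<n))
  where
  periodic : n % suc k ≡ (n ∸ suc k) % suc k
  periodic = trans (cong (_% suc k) (sym (m∸n+n≡m k<n))) ([m+n]%n≡m%n (n ∸ suc k) (suc k))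
... | no  k≮n = begin
  geo k n                            ≡⟨ cong (λ r → if r ≡ᵇ 0 then 1 else 0) (m<n⇒m%n≡m (≰⇒> k≮n)) ⟩
  (if n ≡ᵇ 0 then 1 else 0)          ≡⟨ indicator n ⟩
  oneS n                             ≡⟨ +-identityʳ (oneS n) ⟨
  oneS n + 0                         ≡⟨ cong (oneS n +_) (shift-> (geo k) (≰⇒> k≮n)) ⟨
  oneS n + shift (suc k) (geo k) n   ∎
  where
  open ≡-Reasoning
  indicator : ∀ n → (if n ≡ᵇ 0 then 1 else 0) ≡ oneS n
  indicator zero    = refl
  indicator (suc n) = refl

⊛-geo : ∀ (f : Series) k → f ⊛ geo k ≗ f ⊕ shift (suc k) (f ⊛ geo k)
⊛-geo f k n = begin
  (f ⊛ geo k) n                                  ≡⟨ ⊛-congʳ f (geo-unfold k) n ⟩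
  (f ⊛ (oneS ⊕ shift (suc k) (geo k))) n         ≡⟨ ⊛-distribˡ-⊕ f oneS (shift (suc k) (geo k)) n ⟩
  (f ⊛ oneS) n + (f ⊛ shift (suc k) (geo k)) n   ≡⟨ cong₂ _+_ (⊛-identityʳ f n) (⊛-shift (suc k) f (geo k) n) ⟩
  f n + shift (suc k) (f ⊛ geo k) n              ∎
  where open ≡-Reasoning

-- The summands of the double sum

qProd : ℕ → ℕ → Series
qProd i j = invQPoch i ⊛ invQ2Poch j

qProd-suc-i : ∀ i j → qProd (suc i) j ≗ qProd i j ⊕ shift (suc i) (qProd (suc i) j)
qProd-suc-i i j n = begin
  ((P ⊛ geo i) ⊛ Q) n                              ≡⟨ ⊛-congˡ Q (⊛-geo P i) n ⟩
  ((P ⊕ shift (suc i) (P ⊛ geo i)) ⊛ Q) n          ≡⟨ ⊛-distribʳ-⊕ P (shift (suc i) (P ⊛ geo i)) Q n ⟩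
  (P ⊛ Q) n + (shift (suc i) (P ⊛ geo i) ⊛ Q) n    ≡⟨ cong ((P ⊛ Q) n +_) (shift-⊛ (suc i) (P ⊛ geo i) Q n) ⟩
  (P ⊛ Q) n + shift (suc i) ((P ⊛ geo i) ⊛ Q) n    ∎
  where
  open ≡-Reasoning
  P = invQPoch i
  Q = invQ2Poch j

qProd-suc-j : ∀ i j → qProd i (suc j) ≗ qProd i j ⊕ shift (2 * suc j) (qProd i (suc j))
qProd-suc-j i j n = begin
  (P ⊛ (Q ⊛ g)) n                                 ≡⟨ ⊛-congʳ P (⊛-geo Q (suc (2 * j))) n ⟩
  (P ⊛ (Q ⊕ shift s (Q ⊛ g))) n                   ≡⟨ ⊛-distribˡ-⊕ P Q (shift s (Q ⊛ g)) n ⟩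
  (P ⊛ Q) n + (P ⊛ shift s (Q ⊛ g)) n             ≡⟨ cong ((P ⊛ Q) n +_) (⊛-shift s P (Q ⊛ g) n) ⟩
  (P ⊛ Q) n + shift s (P ⊛ (Q ⊛ g)) n             ≡⟨ cong (λ d → (P ⊛ Q) n + shift d (P ⊛ (Q ⊛ g)) n) (*-suc 2 j) ⟨
  (P ⊛ Q) n + shift (2 * suc j) (P ⊛ (Q ⊛ g)) n   ∎
  where
  open ≡-Reasoning
  P = invQPoch i
  Q = invQ2Poch j
  g = geo (suc (2 * j))
  s = suc (suc (2 * j))

atPred : ℕ → (ℕ → Series) → Series
atPred zero    f = λ _ → 0
atPred (suc k) f = f k

qProd-rec-i : ∀ i j → qProd i j ≗ atPred i (λ i′ → qProd i′ j) ⊕ shift i (qProd i j)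
qProd-rec-i zero    j n = refl
qProd-rec-i (suc i) j   = qProd-suc-i i j

qProd-rec-j : ∀ i j → qProd i j ≗ atPred j (qProd i) ⊕ shift (2 * j) (qProd i j)
qProd-rec-j i zero    n = refl
qProd-rec-j i (suc j)   = qProd-suc-j i j

m+2*[1+n]≡2+m+2*n : ∀ m n → m + 2 * suc n ≡ suc (suc (m + 2 * n))
m+2*[1+n]≡2+m+2*n = solve-∀

-- the (i, j) summand without its factor x^i y^(i+2j)
summand : ℕ → ℕ → Series
summand i j = shift (expo i j) (qProd i j)

-- expo is unfolded in the next two statements, since the ring solver does not unfold it.
expo-suc-i : ∀ i j → (suc i * suc i + 2 * suc i * j + 2 * j * j + j) + 2 * j
                     ≡ suc (2 * (i + 2 * j)) + (i * i + 2 * i * j + 2 * j * j + j)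
expo-suc-i = solve-∀

expo-suc-j : ∀ i j → i * i + 2 * i * suc j + 2 * suc j * suc j + suc j
                     ≡ suc (2 * suc (i + 2 * j)) + (i * i + 2 * i * j + 2 * j * j + j)
expo-suc-j = solve-∀

shift-qProd-pred-i : ∀ i j b → suc b ≡ i + 2 * j →
  shift (expo i j + 2 * j) (atPred i (λ i′ → qProd i′ j)) ≗ shift (suc (2 * b)) (atPred i (λ i′ → summand i′ j))
shift-qProd-pred-i zero    j b _ n = trans (shift-zero (expo 0 j + 2 * j) n) (sym (shift-zero (suc (2 * b)) n))
shift-qProd-pred-i (suc i) j b e n = begin
  shift (expo (suc i) j + 2 * j) Q n             ≡⟨ cong (λ d → shift d Q n) (expo-suc-i i j) ⟩
  shift (suc (2 * (i + 2 * j)) + expo i j) Q n   ≡⟨ cong (λ c → shift (suc (2 * c) + expo i j) Q n) (suc-injective e) ⟨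
  shift (suc (2 * b) + expo i j) Q n             ≡⟨ shift-shift (suc (2 * b)) (expo i j) Q n ⟨
  shift (suc (2 * b)) (summand i j) n            ∎
  where
  open ≡-Reasoning
  Q = qProd i j

shift-qProd-pred-j : ∀ i j b → suc b ≡ i + 2 * j →
  shift (expo i j) (atPred j (qProd i)) ≗ shift (suc (2 * b)) (atPred j (summand i))
shift-qProd-pred-j i zero    b _ n = trans (shift-zero (expo i 0) n) (sym (shift-zero (suc (2 * b)) n))
shift-qProd-pred-j i (suc j) b e n = begin
  shift (expo i (suc j)) Q n                       ≡⟨ cong (λ d → shift d Q n) (expo-suc-j i j) ⟩
  shift (suc (2 * suc (i + 2 * j)) + expo i j) Q n ≡⟨ cong (λ c → shift (suc (2 * c) + expo i j) Q n) b≡ ⟨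
  shift (suc (2 * b) + expo i j) Q n               ≡⟨ shift-shift (suc (2 * b)) (expo i j) Q n ⟨
  shift (suc (2 * b)) (summand i j) n              ∎
  where
  open ≡-Reasoning
  Q = qProd i j
  b≡ : b ≡ suc (i + 2 * j)
  b≡ = suc-injective (trans e (m+2*[1+n]≡2+m+2*n i j))

summand-rec : ∀ i j b → suc b ≡ i + 2 * j →
  summand i j ≗ shift (suc b) (summand i j)
                ⊕ (shift (suc (2 * b)) (atPred i (λ i′ → summand i′ j)) ⊕ shift (suc (2 * b)) (atPred j (summand i)))
summand-rec i j b e n = begin
  shift E Q n
    ≡⟨ shift-cong E (λ m → trans (qProd-rec-j i j m) (cong (Qj m +_) (shift-cong (2 * j) (qProd-rec-i i j) m))) n ⟩
  shift E (Qj ⊕ shift (2 * j) (Qi ⊕ shift i Q)) n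
    ≡⟨ shift-⊕ E Qj (shift (2 * j) (Qi ⊕ shift i Q)) n ⟩
  shift E Qj n + shift E (shift (2 * j) (Qi ⊕ shift i Q)) n
    ≡⟨ cong (shift E Qj n +_) (trans (shift-shift E (2 * j) (Qi ⊕ shift i Q) n) (shift-⊕ (E + 2 * j) Qi (shift i Q) n)) ⟩
  shift E Qj n + (shift (E + 2 * j) Qi n + shift (E + 2 * j) (shift i Q) n)
    ≡⟨ cong₂ (λ x y → x + (y + shift (E + 2 * j) (shift i Q) n))
             (shift-qProd-pred-j i j b e n) (shift-qProd-pred-i i j b e n) ⟩
  Sj + (Si + shift (E + 2 * j) (shift i Q) n)
    ≡⟨ cong (λ z → Sj + (Si + z)) self ⟩
  Sj + (Si + shift (suc b) (summand i j) n)
    ≡⟨ rotate Sj Si (shift (suc b) (summand i j) n) ⟩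
  shift (suc b) (summand i j) n + (Si + Sj)
    ∎
  where
  open ≡-Reasoning
  E = expo i j
  Q = qProd i j
  Qi = atPred i (λ i′ → qProd i′ j)
  Qj = atPred j (qProd i)
  Si = shift (suc (2 * b)) (atPred i (λ i′ → summand i′ j)) n
  Sj = shift (suc (2 * b)) (atPred j (summand i)) n
  rotate : ∀ x y z → x + (y + z) ≡ z + (y + x)
  rotate = solve-∀
  reorder : ∀ x y z → x + 2 * y + z ≡ z + 2 * y + x
  reorder = solve-∀
  self : shift (E + 2 * j) (shift i Q) n ≡ shift (suc b) (summand i j) n
  self = begin
    shift (E + 2 * j) (shift i Q) n   ≡⟨ shift-shift (E + 2 * j) i Q n ⟩
    shift (E + 2 * j + i) Q n         ≡⟨ cong (λ d → shift d Q n) (trans (reorder E j i) (cong (_+ E) (sym e))) ⟩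
    shift (suc b + E) Q n             ≡⟨ shift-shift (suc b) E Q n ⟨
    shift (suc b) (summand i j) n     ∎

-- Coefficients of the double sum

≡ᵇ-refl : ∀ n → (n ≡ᵇ n) ≡ true
≡ᵇ-refl n = Equivalence.to T-≡ (≡⇒≡ᵇ n n refl)

≡ᵇ-false : ∀ {m n} → m ≢ n → (m ≡ᵇ n) ≡ false
≡ᵇ-false {m} {n} m≢n = ¬-not (m≢n ∘ ≡ᵇ⇒≡ m n ∘ Equivalence.from T-≡)

term-off-sol : ∀ {i a} j b n → i ≢ a → term i j a b n ≡ 0
term-off-sol j b n i≢a rewrite ≡ᵇ-false (i≢a ∘ sym) = refl

term-off-len : ∀ a j {b} n → b ≢ a + 2 * j → term a j a b n ≡ 0
term-off-len a j n b≢ rewrite ≡ᵇ-refl a | ≡ᵇ-false b≢ = refl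

term-on : ∀ a j n → term a j a (a + 2 * j) n ≡ summand a j n
term-on a j n rewrite ≡ᵇ-refl a | ≡ᵇ-refl (a + 2 * j) = refl

i≤expo : ∀ i j → i ≤ expo i j
i≤expo zero    j = z≤n
i≤expo (suc i) j = ≤-trans (m≤m*n (suc i) (suc i)) (≤-trans (m≤m+n _ _) (≤-trans (m≤m+n _ _) (m≤m+n _ _)))

j≤expo : ∀ i j → j ≤ expo i j
j≤expo i j = m≤n+m j _

-- the exponents (a, b) = (i, i + 2j) of x^a y^b occurring in the double sum
Supported : ℕ → ℕ → Set
Supported a b = ∃[ j ] b ≡ a + 2 * j

supported-2+ : ∀ a {b} → Supported a b → Supported a (2 + b)
supported-2+ a (j , e) = suc j , trans (cong (suc ∘ suc) e) (sym (m+2*[1+n]≡2+m+2*n a j))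

+-2*-injective : ∀ a {j j′} → a + 2 * j ≡ a + 2 * j′ → j ≡ j′
+-2*-injective a e = *-cancelˡ-≡ _ _ 2 (+-cancelˡ-≡ a _ _ e)

supported? : ∀ a b → Dec (Supported a b)
supported? zero    zero          = yes (0 , refl)
supported? zero    (suc zero)    =
  no λ { (zero , ()) ; (suc j , e) → 0≢1+n (suc-injective (trans e (m+2*[1+n]≡2+m+2*n 0 j))) }
supported? zero    (suc (suc b)) = map′ (supported-2+ 0) down (supported? 0 b)
  where
  down : Supported 0 (suc (suc b)) → Supported 0 b
  down (suc j , e) = j , suc-injective (suc-injective (trans e (m+2*[1+n]≡2+m+2*n 0 j)))
supported? (suc a) zero          = no λ ()
supported? (suc a) (suc b)       = map′ (Product.map₂ (cong suc)) (Product.map₂ suc-injective) (supported? a b)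

rhsCoeff-on : ∀ a {b} j → b ≡ a + 2 * j → rhsCoeff a b ≗ summand a j
rhsCoeff-on a {b} j refl n = begin
  rhsCoeff a b n         ≡⟨ sumTo≡sumBelow n row ⟩
  sumBelow (suc n) row   ≡⟨ sumBelow-delta (suc n) a off-row (λ n<a → trans on-row (below (≤-trans n<a (i≤expo a j)))) ⟩
  row a                  ≡⟨ on-row ⟩
  summand a j n          ∎
  where
  open ≡-Reasoning
  row : ℕ → ℕ
  row i = sumTo n (λ j′ → term i j′ a b n)
  below : n < expo a j → summand a j n ≡ 0
  below = shift-> (qProd a j)
  off-row : ∀ {i} → i ≢ a → row i ≡ 0
  off-row {i} i≢a =
    trans (sumTo≡sumBelow n (λ j′ → term i j′ a b n)) (sumBelow-zero (suc n) (λ {j′} _ → term-off-sol j′ b n i≢a))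
  off-column : ∀ {j′} → j′ ≢ j → term a j′ a b n ≡ 0
  off-column {j′} j′≢j = term-off-len a j′ n (λ e → j′≢j (+-2*-injective a (sym e)))
  on-row : row a ≡ summand a j n
  on-row = begin
    row a                                          ≡⟨ sumTo≡sumBelow n (λ j′ → term a j′ a b n) ⟩
    sumBelow (suc n) (λ j′ → term a j′ a b n)      ≡⟨ sumBelow-delta (suc n) j off-column
                                                        (λ n<j → trans (term-on a j n) (below (≤-trans n<j (j≤expo a j)))) ⟩
    term a j a b n                                 ≡⟨ term-on a j n ⟩
    summand a j n                                  ∎

rhsCoeff-off : ∀ a b → ¬ Supported a b → rhsCoeff a b ≗ λ _ → 0
rhsCoeff-off a b unsupported n =
  trans (sumTo≡sumBelow n (λ i → sumTo n (λ j → term i j a b n))) (sumBelow-zero (suc n) λ {i} _ →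
    trans (sumTo≡sumBelow n (λ j → term i j a b n)) (sumBelow-zero (suc n) λ {j} _ → vanish i j))
  where
  vanish : ∀ i j → term i j a b n ≡ 0
  vanish i j with i ≟ a
  ... | yes refl = term-off-len a j n (λ e → unsupported (j , e))
  ... | no  i≢a  = term-off-sol j b n i≢a

rhsCoeff-predSol-on : ∀ a b j → suc b ≡ a + 2 * j →
  atPred a (λ a′ → rhsCoeff a′ b) ≗ atPred a (λ a′ → summand a′ j)
rhsCoeff-predSol-on zero    b j _ n = refl
rhsCoeff-predSol-on (suc a) b j e   = rhsCoeff-on a j (suc-injective e)

rhsCoeff-predLen-on : ∀ a b j → suc b ≡ a + 2 * j → atPred b (rhsCoeff a) ≗ atPred j (summand a)
rhsCoeff-predLen-on a zero    zero    _ n = refl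
rhsCoeff-predLen-on a zero    (suc j) e   = contradiction (suc-injective (trans e (m+2*[1+n]≡2+m+2*n a j))) 0≢1+n
rhsCoeff-predLen-on a (suc c) zero    e   = rhsCoeff-off a c unsupported
  where
  unsupported : ¬ Supported a c
  unsupported s = 0≢1+n (+-2*-injective a (trans (sym e) (proj₂ (supported-2+ a s))))
rhsCoeff-predLen-on a (suc c) (suc j) e   =
  rhsCoeff-on a j (suc-injective (suc-injective (trans e (m+2*[1+n]≡2+m+2*n a j))))

rhsCoeff-predSol-off : ∀ a b → ¬ Supported a (suc b) → atPred a (λ a′ → rhsCoeff a′ b) ≗ λ _ → 0
rhsCoeff-predSol-off zero    b _           n = refl
rhsCoeff-predSol-off (suc a) b unsupported   = rhsCoeff-off a b (unsupported ∘ Product.map₂ (cong suc))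

rhsCoeff-predLen-off : ∀ a b → ¬ Supported a (suc b) → atPred b (rhsCoeff a) ≗ λ _ → 0
rhsCoeff-predLen-off a zero    _           n = refl
rhsCoeff-predLen-off a (suc c) unsupported   = rhsCoeff-off a c (unsupported ∘ supported-2+ a)

rhsCoeff-suc : ∀ a b →
  rhsCoeff a (suc b) ≗ shift (suc b) (rhsCoeff a (suc b))
                       ⊕ (shift (suc (2 * b)) (atPred a (λ a′ → rhsCoeff a′ b)) ⊕ shift (suc (2 * b)) (atPred b (rhsCoeff a)))
rhsCoeff-suc a b n with supported? a (suc b)
... | yes (j , e) = begin
  rhsCoeff a (suc b) n
    ≡⟨ rhsCoeff-on a j e n ⟩
  summand a j n
    ≡⟨ summand-rec a j b e n ⟩
  shift (suc b) (summand a j) n + (shift d (atPred a (λ a′ → summand a′ j)) n + shift d (atPred j (summand a)) n)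
    ≡⟨ cong₂ _+_ (shift-cong (suc b) (rhsCoeff-on a j e) n)
                 (cong₂ _+_ (shift-cong d (rhsCoeff-predSol-on a b j e) n) (shift-cong d (rhsCoeff-predLen-on a b j e) n)) ⟨
  shift (suc b) (rhsCoeff a (suc b)) n + (shift d (atPred a (λ a′ → rhsCoeff a′ b)) n + shift d (atPred b (rhsCoeff a)) n)
    ∎
  where
  open ≡-Reasoning
  d = suc (2 * b)
... | no unsupported =
  trans (rhsCoeff-off a (suc b) unsupported n)
        (sym (cong₂ _+_ (vanish (suc b) (rhsCoeff-off a (suc b) unsupported))
                        (cong₂ _+_ (vanish (suc (2 * b)) (rhsCoeff-predSol-off a b unsupported))
                                   (vanish (suc (2 * b)) (rhsCoeff-predLen-off a b unsupported)))))
  where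
  vanish : ∀ d {f} → f ≗ (λ _ → 0) → shift d f n ≡ 0
  vanish d f≗0 = trans (shift-cong d f≗0 n) (shift-zero d n)

-- Raising strict partitions

raise : ℕ → List ℕ → List ℕ
raise d = map (d +_)

withIsolatedOne : List ℕ → List ℕ
withIsolatedOne ν = 1 ∷ raise 2 ν

withOneTwo : List ℕ → List ℕ
withOneTwo ν = 1 ∷ 2 ∷ raise 2 ν

length-raise : ∀ d ν → length (raise d ν) ≡ length ν
length-raise d = length-map (d +_)

sum-raise : ∀ d ν → sum (raise d ν) ≡ d * length ν + sum ν
sum-raise d []      = sym (cong (_+ 0) (*-zeroʳ d))
sum-raise d (x ∷ ν) = trans (cong (d + x +_) (sum-raise d ν)) (shuffle d x (length ν) (sum ν))
  where
  shuffle : ∀ d x l s → d + x + (d * l + s) ≡ d * suc l + (x + s)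
  shuffle = solve-∀

≡ᵇ-cancelˡ : ∀ d m n → (d + m ≡ᵇ d + n) ≡ (m ≡ᵇ n)
≡ᵇ-cancelˡ zero    m n = refl
≡ᵇ-cancelˡ (suc d) m n = ≡ᵇ-cancelˡ d m n

runsFrom-raise : ∀ d p l ys → runsFrom (d + p) l (raise d ys) ≡ runsFrom p l ys
runsFrom-raise d p l []       = refl
runsFrom-raise d p l (y ∷ ys) rewrite sym (+-suc d p) | ≡ᵇ-cancelˡ d y (suc p) with y ≡ᵇ suc p
... | true  = runsFrom-raise d y (suc l) ys
... | false = cong (l ∷_) (runsFrom-raise d y 1 ys)

sol-raise : ∀ d ν → sol (raise d ν) ≡ sol ν
sol-raise d []      = refl
sol-raise d (x ∷ ν) = cong countOdd (runsFrom-raise d x 1 ν)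

sol-withIsolatedOne : ∀ {ν} → All (0 <_) ν → sol (withIsolatedOne ν) ≡ suc (sol ν)
sol-withIsolatedOne {[]}         []      = refl
sol-withIsolatedOne {suc y ∷ ys} (_ ∷ _) = cong (suc ∘ countOdd) (runsFrom-raise 2 (suc y) 1 ys)

-- runsFrom 0 0 reads ν as continuing a sequence of length 0, which is even.
countOdd-runsFrom-0-0 : ∀ ν → countOdd (runsFrom 0 0 ν) ≡ sol ν
countOdd-runsFrom-0-0 []       = refl
countOdd-runsFrom-0-0 (y ∷ ys) with y ≡ᵇ 1
... | true  = refl
... | false = refl

countOdd-runsFrom-2+ : ∀ p l ys → countOdd (runsFrom (2 + p) (2 + l) (raise 2 ys)) ≡ countOdd (runsFrom p l ys)
countOdd-runsFrom-2+ p l []       = refl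
countOdd-runsFrom-2+ p l (y ∷ ys) with y ≡ᵇ suc p
... | true  = countOdd-runsFrom-2+ y (suc l) ys
... | false = cong (countOdd ∘ (l ∷_)) (runsFrom-raise 2 y 1 ys)

sol-withOneTwo : ∀ ν → sol (withOneTwo ν) ≡ sol ν
sol-withOneTwo ν = trans (countOdd-runsFrom-2+ 0 0 ν) (countOdd-runsFrom-0-0 ν)

strict-raise : ∀ d {ν} → IsStrictPartition ν → IsStrictPartition (raise d ν)
strict-raise d (pos , lk) =
  All.map⁺ (All.map (λ 0<x → <-≤-trans 0<x (m≤n+m _ d)) pos) , Linked.map⁺ (Linked.map (+-monoʳ-< d) lk)

strict-withIsolatedOne : ∀ {ν} → IsStrictPartition ν → IsStrictPartition (withIsolatedOne ν)
strict-withIsolatedOne {[]}    _ = z<s ∷ [] , [-]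
strict-withIsolatedOne {x ∷ ν} s = z<s ∷ proj₁ (strict-raise 2 s) , s≤s (s≤s z≤n) ∷ proj₂ (strict-raise 2 s)

strict-withOneTwo : ∀ {ν} → IsStrictPartition ν → IsStrictPartition (withOneTwo ν)
strict-withOneTwo {[]}    _                 = z<s ∷ z<s ∷ [] , s≤s (s≤s z≤n) ∷ [-]
strict-withOneTwo {x ∷ ν} s@(0<x ∷ _ , _) =
  z<s ∷ z<s ∷ proj₁ (strict-raise 2 s) , s≤s (s≤s z≤n) ∷ +-monoʳ-< 2 0<x ∷ proj₂ (strict-raise 2 s)

unraise : ∀ d {zs} → All (d <_) zs → ∃[ ν ] zs ≡ raise d ν × All (0 <_) ν
unraise d {[]}     []         = [] , refl , []
unraise d {z ∷ zs} (d<z ∷ ds) with unraise d ds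
... | ν , refl , pos = z ∸ d ∷ ν , cong (_∷ raise d ν) (sym (m+[n∸m]≡n (<⇒≤ d<z))) , m<n⇒0<n∸m d<z ∷ pos

lower : ∀ d {zs} → All (d <_) zs → Linked _<_ zs → ∃[ ν ] zs ≡ raise d ν × IsStrictPartition ν
lower d ds lk with unraise d ds
... | ν , refl , pos = ν , refl , pos , Linked.map (+-cancelˡ-< d _ _) (Linked.map⁻ lk)

data SmallestParts : List ℕ → Set where
  none        : SmallestParts []
  atLeastTwo  : ∀ {ν} → IsStrictPartition ν → SmallestParts (raise 1 ν)
  isolatedOne : ∀ {ν} → IsStrictPartition ν → SmallestParts (withIsolatedOne ν)
  oneTwo      : ∀ {ν} → IsStrictPartition ν → SmallestParts (withOneTwo ν)

smallestParts : ∀ {μ} → IsStrictPartition μ → SmallestParts μ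
smallestParts {[]}               _ = none
smallestParts {zero ∷ _}         (() ∷ _ , _)
smallestParts {suc (suc x) ∷ xs} (_ , lk) with lower 1 (Linked⇒All <-trans (s≤s (s≤s z≤n)) lk) lk
... | ν , e , sν = subst SmallestParts (sym e) (atLeastTwo sν)
smallestParts {1 ∷ []}           _ = isolatedOne {[]} ([] , [])
smallestParts {1 ∷ 2 ∷ ys}       (_ , _ ∷ lk) with lower 2 (AllPairs.head (Linked⇒AllPairs <-trans lk)) (Linked.tail lk)
... | ν , e , sν = subst (SmallestParts ∘ (1 ∷_) ∘ (2 ∷_)) (sym e) (oneTwo sν)
smallestParts {1 ∷ suc (suc (suc y)) ∷ ys} (_ , _ ∷ lk) with lower 2 (Linked⇒All <-trans (s≤s (s≤s (s≤s z≤n))) lk) lk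
... | ν , e , sν = subst (SmallestParts ∘ (1 ∷_)) (sym e) (isolatedOne sν)
smallestParts {1 ∷ 1 ∷ _}        (_ , s≤s () ∷ _)

raise₁≢1∷ : ∀ {ν xs} → All (0 <_) ν → raise 1 ν ≢ 1 ∷ xs
raise₁≢1∷ {zero  ∷ _} (() ∷ _)
raise₁≢1∷ {suc _ ∷ _} _ ()

withIsolatedOne≢withOneTwo : ∀ {ν ν′} → All (0 <_) ν → withIsolatedOne ν ≢ withOneTwo ν′
withIsolatedOne≢withOneTwo {zero  ∷ _} (() ∷ _)
withIsolatedOne≢withOneTwo {suc _ ∷ _} _ ()

-- Counting strict partitions by sol, length and size

Counted : ℕ → ℕ → ℕ → List ℕ → Set
Counted a b n μ = IsStrictPartition μ × sum μ ≡ n × sol μ ≡ a × length μ ≡ b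

record Extension (f : List ℕ → List ℕ) (Δsol Δlen : ℕ) (weight : ℕ → ℕ) : Set where
  field
    injective  : ∀ {ν ν′} → f ν ≡ f ν′ → ν ≡ ν′
    strict     : ∀ {ν} → IsStrictPartition ν → IsStrictPartition (f ν)
    sum-ext    : ∀ ν → sum (f ν) ≡ weight (length ν) + sum ν
    sol-ext    : ∀ {ν} → IsStrictPartition ν → sol (f ν) ≡ Δsol + sol ν
    length-ext : ∀ ν → length (f ν) ≡ Δlen + length ν

  counted⁺ : ∀ {a b m ν} → Counted a b m ν → Counted (Δsol + a) (Δlen + b) (weight b + m) (f ν)
  counted⁺ {ν = ν} (sν , refl , refl , refl) = strict sν , sum-ext ν , sol-ext sν , length-ext ν

  counted⁻ : ∀ {a b n ν} → IsStrictPartition ν → Counted (Δsol + a) (Δlen + b) n (f ν) →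
             weight b ≤ n × Counted a b (n ∸ weight b) ν
  counted⁻ {a} {b} {n} {ν} sν (_ , s , so , l) =
    subst (weight b ≤_) sum≡ (m≤m+n (weight b) (sum ν)) ,
    sν , sym (trans (cong (_∸ weight b) (sym sum≡)) (m+n∸m≡n (weight b) (sum ν))) , sol≡ , len≡
    where
    len≡ : length ν ≡ b
    len≡ = +-cancelˡ-≡ Δlen _ _ (trans (sym (length-ext ν)) l)
    sol≡ : sol ν ≡ a
    sol≡ = +-cancelˡ-≡ Δsol _ _ (trans (sym (sol-ext sν)) so)
    sum≡ : weight b + sum ν ≡ n
    sum≡ = trans (cong (λ ℓ → weight ℓ + sum ν) (sym len≡)) (trans (sym (sum-ext ν)) s)

raise₁-extension : Extension (raise 1) 0 0 (λ ℓ → ℓ)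
raise₁-extension = record
  { injective  = map-injective suc-injective
  ; strict     = strict-raise 1
  ; sum-ext    = λ ν → trans (sum-raise 1 ν) (cong (_+ sum ν) (*-identityˡ (length ν)))
  ; sol-ext    = λ {ν} _ → sol-raise 1 ν
  ; length-ext = length-raise 1
  }

isolatedOne-extension : Extension withIsolatedOne 1 1 (λ ℓ → suc (2 * ℓ))
isolatedOne-extension = record
  { injective  = map-injective (+-cancelˡ-≡ 2 _ _) ∘ ∷-injectiveʳ
  ; strict     = strict-withIsolatedOne
  ; sum-ext    = λ ν → cong suc (sum-raise 2 ν)
  ; sol-ext    = sol-withIsolatedOne ∘ proj₁
  ; length-ext = λ ν → cong suc (length-raise 2 ν)
  }

oneTwo-extension : Extension withOneTwo 0 2 (λ ℓ → suc (2 * suc ℓ))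
oneTwo-extension = record
  { injective  = map-injective (+-cancelˡ-≡ 2 _ _) ∘ ∷-injectiveʳ ∘ ∷-injectiveʳ
  ; strict     = strict-withOneTwo
  ; sum-ext    = λ ν → cong suc (trans (cong (2 +_) (sum-raise 2 ν)) (regroup (length ν) (sum ν)))
  ; sol-ext    = λ {ν} _ → sol-withOneTwo ν
  ; length-ext = λ ν → cong (suc ∘ suc) (length-raise 2 ν)
  }
  where
  regroup : ∀ ℓ s → 2 + (2 * ℓ + s) ≡ 2 * suc ℓ + s
  regroup = solve-∀

extend : (List ℕ → List ℕ) → ℕ → ℕ → (ℕ → List (List ℕ)) → List (List ℕ)
extend f d n L = if d ≤ᵇ n then map f (L (n ∸ d)) else []

module _ (f : List ℕ → List ℕ) (d n : ℕ) (L : ℕ → List (List ℕ)) where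

  ∈-extend⁻ : ∀ {μ} → μ ∈ extend f d n L → ∃[ ν ] d ≤ n × ν ∈ L (n ∸ d) × μ ≡ f ν
  ∈-extend⁻ μ∈ with d ≤ᵇ n | ≤ᵇ-reflects-≤ d n
  ... | true | ofʸ d≤n = let ν , ν∈ , μ≡ = ∈-map⁻ f μ∈ in ν , d≤n , ν∈ , μ≡

  ∈-extend⁺ : ∀ {ν} → d ≤ n → ν ∈ L (n ∸ d) → f ν ∈ extend f d n L
  ∈-extend⁺ d≤n ν∈ with d ≤ᵇ n | ≤ᵇ-reflects-≤ d n
  ... | true  | _       = ∈-map⁺ f ν∈
  ... | false | ofⁿ d≰n = contradiction d≤n d≰n

  length-extend : length (extend f d n L) ≡ shift d (length ∘ L) n
  length-extend with d ≤ᵇ n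
  ... | true  = length-map f (L (n ∸ d))
  ... | false = refl

  unique-extend : (∀ {ν ν′} → f ν ≡ f ν′ → ν ≡ ν′) → Unique (L (n ∸ d)) → Unique (extend f d n L)
  unique-extend injective u with d ≤ᵇ n
  ... | true  = Unique.map⁺ injective u
  ... | false = AllPairs.[]

module _ {f : List ℕ → List ℕ} {Δsol Δlen : ℕ} {weight : ℕ → ℕ} (E : Extension f Δsol Δlen weight)
         {a b n : ℕ} (L : ℕ → List (List ℕ)) where
  open Extension E

  sound-extend : (∀ {ν} → ν ∈ L (n ∸ weight b) → Counted a b (n ∸ weight b) ν) →
                 ∀ {μ} → μ ∈ extend f (weight b) n L → Counted (Δsol + a) (Δlen + b) n μ
  sound-extend sound-L μ∈ with ∈-extend⁻ f (weight b) n L μ∈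
  ... | ν , w≤n , ν∈ , refl = subst (λ m → Counted _ _ m (f ν)) (m+[n∸m]≡n w≤n) (counted⁺ (sound-L ν∈))

  complete-extend : 0 < weight b → (∀ {ν m} → m < n → Counted a b m ν → ν ∈ L m) →
                    ∀ {ν} → IsStrictPartition ν → Counted (Δsol + a) (Δlen + b) n (f ν) →
                    f ν ∈ extend f (weight b) n L
  complete-extend 0<w complete-L sν c with counted⁻ sν c
  ... | w≤n , c′ = ∈-extend⁺ f (weight b) n L w≤n (complete-L (∸-monoʳ-< 0<w w≤n) c′)

emptyPartition : ℕ → ℕ → List (List ℕ)
emptyPartition zero zero = [ [] ]
emptyPartition _    _    = []

-- k is fuel: the list is complete only for n < k.
mutual
  strictPartitions : ℕ → ℕ → ℕ → ℕ → List (List ℕ)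
  strictPartitions zero    a b       n = []
  strictPartitions (suc k) a zero    n = emptyPartition a n
  strictPartitions (suc k) a (suc b) n =
    raisedPartitions k a b n ++ (isolatedOnePartitions k a b n ++ oneTwoPartitions k a b n)

  raisedPartitions : ℕ → ℕ → ℕ → ℕ → List (List ℕ)
  raisedPartitions k a b n = extend (raise 1) (suc b) n (strictPartitions k a (suc b))

  isolatedOnePartitions : ℕ → ℕ → ℕ → ℕ → List (List ℕ)
  isolatedOnePartitions k zero    b n = []
  isolatedOnePartitions k (suc a) b n = extend withIsolatedOne (suc (2 * b)) n (strictPartitions k a b)

  oneTwoPartitions : ℕ → ℕ → ℕ → ℕ → List (List ℕ)
  oneTwoPartitions k a zero    n = []
  oneTwoPartitions k a (suc c) n = extend withOneTwo (suc (2 * suc c)) n (strictPartitions k a c)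

sound : ∀ k a b n {μ} → μ ∈ strictPartitions k a b n → Counted a b n μ
sound (suc k) zero zero    zero (here refl) = ([] , []) , refl , refl , refl
sound (suc k) a    (suc b) n {μ} μ∈ =
  [ sound-extend raise₁-extension (strictPartitions k a (suc b)) (sound k a (suc b) _)
  , [ isolated a , pair b ]′ ∘ ∈-++⁻ (isolatedOnePartitions k a b n)
  ]′ (∈-++⁻ (raisedPartitions k a b n) μ∈)
  where
  isolated : ∀ a → μ ∈ isolatedOnePartitions k a b n → Counted a (suc b) n μ
  isolated (suc a) = sound-extend isolatedOne-extension (strictPartitions k a b) (sound k a b _)
  pair : ∀ b → μ ∈ oneTwoPartitions k a b n → Counted a (suc b) n μ
  pair (suc c) = sound-extend oneTwo-extension (strictPartitions k a c) (sound k a c _)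

CompleteBelow : ℕ → ℕ → Set
CompleteBelow k n = ∀ {a b m ν} → m < n → Counted a b m ν → ν ∈ strictPartitions k a b m

complete-suc : ∀ k a b n → CompleteBelow k n →
               ∀ {μ} → Counted a (suc b) n μ → μ ∈ strictPartitions (suc k) a (suc b) n
complete-suc k a b n complete-k c with smallestParts (proj₁ c)
... | atLeastTwo sν =
  ∈-++⁺ˡ (complete-extend raise₁-extension (strictPartitions k a (suc b)) z<s complete-k sν c)
... | isolatedOne sν = ∈-++⁺ʳ (raisedPartitions k a b n) (∈-++⁺ˡ (isolated a c))
  where
  isolated : ∀ a → Counted a (suc b) n _ → _ ∈ isolatedOnePartitions k a b n
  isolated zero    (_ , _ , sol≡0 , _) = contradiction (trans (sym (sol-withIsolatedOne (proj₁ sν))) sol≡0) 1+n≢0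
  isolated (suc a) c = complete-extend isolatedOne-extension (strictPartitions k a b) z<s complete-k sν c
... | oneTwo sν = ∈-++⁺ʳ (raisedPartitions k a b n) (∈-++⁺ʳ (isolatedOnePartitions k a b n) (pair b c))
  where
  pair : ∀ b → Counted a (suc b) n _ → _ ∈ oneTwoPartitions k a b n
  pair zero    (_ , _ , _ , ())
  pair (suc c) c′ = complete-extend oneTwo-extension (strictPartitions k a c) z<s complete-k sν c′

complete : ∀ k a b n {μ} → n < k → Counted a b n μ → μ ∈ strictPartitions k a b n
complete (suc k) a zero    n {[]} _ (_ , refl , refl , _) = here refl
complete (suc k) a (suc b) n n<1+k c =
  complete-suc k a b n (λ m<n → complete k _ _ _ (<-≤-trans m<n (s≤s⁻¹ n<1+k))) c

startsWithOne : ∀ k a b n {μ} → μ ∈ isolatedOnePartitions k a b n ++ oneTwoPartitions k a b n → ∃[ xs ] μ ≡ 1 ∷ xs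
startsWithOne k a b n μ∈ with ∈-++⁻ (isolatedOnePartitions k a b n) μ∈
startsWithOne k (suc a) b n _ | inj₁ μ∈ with ∈-extend⁻ withIsolatedOne (suc (2 * b)) n (strictPartitions k a b) μ∈
... | ν , _ , _ , refl = raise 2 ν , refl
startsWithOne k a (suc c) n _ | inj₂ μ∈ with ∈-extend⁻ withOneTwo (suc (2 * suc c)) n (strictPartitions k a c) μ∈
... | ν , _ , _ , refl = 2 ∷ raise 2 ν , refl

unique : ∀ k a b n → Unique (strictPartitions k a b n)
unique zero    a       b       n       = AllPairs.[]
unique (suc k) zero    zero    zero    = [] AllPairs.∷ AllPairs.[]
unique (suc k) zero    zero    (suc n) = AllPairs.[]
unique (suc k) (suc a) zero    n       = AllPairs.[]
unique (suc k) a       (suc b) n       =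
  Unique.++⁺ (unique-extend (raise 1) (suc b) n (strictPartitions k a (suc b))
                            (Extension.injective raise₁-extension) (unique k a (suc b) _))
             (Unique.++⁺ (isolated a) (pair b) isolated∩pair)
             raised∩rest
  where
  isolated : ∀ a → Unique (isolatedOnePartitions k a b n)
  isolated zero    = AllPairs.[]
  isolated (suc a) = unique-extend withIsolatedOne (suc (2 * b)) n (strictPartitions k a b)
                                   (Extension.injective isolatedOne-extension) (unique k a b _)
  pair : ∀ b → Unique (oneTwoPartitions k a b n)
  pair zero    = AllPairs.[]
  pair (suc c) = unique-extend withOneTwo (suc (2 * suc c)) n (strictPartitions k a c)
                               (Extension.injective oneTwo-extension) (unique k a c _)
  positive : ∀ {a b m ν} → ν ∈ strictPartitions k a b m → All (0 <_) ν
  positive ν∈ = proj₁ (proj₁ (sound k _ _ _ ν∈))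
  raised∩rest : Disjoint (raisedPartitions k a b n) (isolatedOnePartitions k a b n ++ oneTwoPartitions k a b n)
  raised∩rest (μ∈ , μ∈′) with ∈-extend⁻ (raise 1) (suc b) n (strictPartitions k a (suc b)) μ∈
  ... | ν , _ , ν∈ , refl = raise₁≢1∷ (positive ν∈) (proj₂ (startsWithOne k a b n μ∈′))
  isolated∩pair : Disjoint (isolatedOnePartitions k a b n) (oneTwoPartitions k a b n)
  isolated∩pair {μ} (μ∈ , μ∈′) = apart a b μ∈ μ∈′
    where
    apart : ∀ a b → μ ∈ isolatedOnePartitions k a b n → μ ∈ oneTwoPartitions k a b n → ⊥
    apart (suc a) (suc c) μ∈ μ∈′
      with ∈-extend⁻ withIsolatedOne (suc (2 * suc c)) n (strictPartitions k a (suc c)) μ∈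
         | ∈-extend⁻ withOneTwo (suc (2 * suc c)) n (strictPartitions k (suc a) c) μ∈′
    ... | ν , _ , ν∈ , refl | _ , _ , _ , e = withIsolatedOne≢withOneTwo (positive ν∈) e

rhsCoeff-zero : ∀ a n → rhsCoeff a 0 n ≡ length (emptyPartition a n)
rhsCoeff-zero zero    zero    = rhsCoeff-on 0 0 refl 0
rhsCoeff-zero zero    (suc n) = trans (rhsCoeff-on 0 0 refl (suc n)) (⊛-identityˡ oneS (suc n))
rhsCoeff-zero (suc a) n       = rhsCoeff-off (suc a) 0 (λ ()) n

count : ∀ k a b n → n < k → length (strictPartitions k a b n) ≡ rhsCoeff a b n
count (suc k) a zero    n _     = sym (rhsCoeff-zero a n)
count (suc k) a (suc b) n n<1+k = begin
  length (A ++ (B ++ C))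
    ≡⟨ trans (length-++ A) (cong (length A +_) (length-++ B)) ⟩
  length A + (length B + length C)
    ≡⟨ cong₂ _+_ (count-extend (raise 1) z<s) (cong₂ _+_ (count-isolated a) (count-pair b)) ⟩
  shift (suc b) (rhsCoeff a (suc b)) n
    + (shift (suc (2 * b)) (atPred a (λ a′ → rhsCoeff a′ b)) n + shift (suc (2 * b)) (atPred b (rhsCoeff a)) n)
    ≡⟨ rhsCoeff-suc a b n ⟨
  rhsCoeff a (suc b) n
    ∎
  where
  open ≡-Reasoning
  A = raisedPartitions k a b n
  B = isolatedOnePartitions k a b n
  C = oneTwoPartitions k a b n
  count-extend : ∀ f {d a b} → 0 < d → length (extend f d n (strictPartitions k a b)) ≡ shift d (rhsCoeff a b) n
  count-extend f {d} {a} {b} 0<d =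
    trans (length-extend f d n (strictPartitions k a b))
          (shift-cong-at d n {length ∘ strictPartitions k a b} {rhsCoeff a b}
                         (λ d≤n → count k a b (n ∸ d) (<-≤-trans (∸-monoʳ-< 0<d d≤n) (s≤s⁻¹ n<1+k))))
  count-isolated : ∀ a → length (isolatedOnePartitions k a b n) ≡ shift (suc (2 * b)) (atPred a (λ a′ → rhsCoeff a′ b)) n
  count-isolated zero    = sym (shift-zero (suc (2 * b)) n)
  count-isolated (suc a) = count-extend withIsolatedOne z<s
  count-pair : ∀ b → length (oneTwoPartitions k a b n) ≡ shift (suc (2 * b)) (atPred b (rhsCoeff a)) n
  count-pair zero    = sym (shift-zero 1 n)
  count-pair (suc c) = count-extend withOneTwo z<s

theorem1p3 : (a b n : ℕ) →
    Σ (List (List ℕ)) (λ L →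
      Unique L
      × ((μ : List ℕ) → (μ ∈ L) ⇔ (IsStrictPartition μ × sum μ ≡ n × sol μ ≡ a × length μ ≡ b))
      × length L ≡ rhsCoeff a b n)
theorem1p3 a b n =
  strictPartitions (suc n) a b n ,
  unique (suc n) a b n ,
  (λ μ → mk⇔ (sound (suc n) a b n) (complete (suc n) a b n ≤-refl)) ,
  count (suc n) a b n ≤-refl
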